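{- Let $k\geq 2$ and let $X$ be a $k$-edge-connected multigraph. Then the complete generalized truncation $Y$ of $X$ is $k$-edge-connected.
   Context: A multigraph may have multiple edges but no loops; it is assumed to have no isolated vertices. Generalized truncation of $X$: take a matching $M_0$ with $|M_0|=|E(X)|$ (on $2|E(X)|$ new vertices) and a bijection $F:E(X)\to M_0$; for each edge $e$ of $X$ with ends $u,v$, label one end of $F(e)$ by $u$ and the other by $v$. For $v\in V(X)$, the cluster $\mathrm{cl}(v)$ is the set of vertices labelled $v$; insert a graph $\mathrm{con}(v)$ (constituent) on $\mathrm{cl}(v)$. The result $F(M_0)\cup\bigcup_v\mathrm{con}(v)$ is a generalized truncation. It is complete if every constituent is a complete graph (this determines it up to isomorphism). A multigraph is $k$-edge-connected if every pair of distinct vertices is joined by $k$ mutually edge-disjoint paths. -}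

module Defs where

open import Data.Nat using (ℕ; _<ᵇ_)
open import Data.Fin using (Fin; toℕ)
open import Data.Fin.Properties using (_≟_)
open import Data.Bool using (Bool; true; false; _∧_; _∨_; T)
open import Data.Product using (Σ; _×_; _,_; proj₁; proj₂)
open import Data.Sum using (_⊎_; inj₁; inj₂)
open import Data.List using (List; []; _∷_)
open import Data.List.Membership.Propositional using (_∈_)
open import Data.List.Relation.Unary.Unique.Propositional using (Unique)
open import Relation.Binary.PropositionalEquality using (_≡_; _≢_)
open import Relation.Nullary.Decidable using (⌊_⌋)
open import Data.Empty using (⊥)

record Graph : Set₁ where
  field
    V    : Set
    E    : Set
    end₁ : E → V
    end₂ : E → V

module _ (G : Graph) where
  open Graph G

  Joins : E → V → V → Set
  Joins e u w = (end₁ e ≡ u × end₂ e ≡ w) ⊎ (end₂ e ≡ u × end₁ e ≡ w)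

  data Walk : V → V → Set where
    []   : ∀ {u} → Walk u u
    step : ∀ {u w v} (e : E) → Joins e u w → Walk w v → Walk u v

  vertices : ∀ {u v} → Walk u v → List V
  vertices {u} []            = u ∷ []
  vertices {u} (step e _ p)  = u ∷ vertices p

  edges : ∀ {u v} → Walk u v → List E
  edges []           = []
  edges (step e _ p) = e ∷ edges p

  IsPath : ∀ {u v} → Walk u v → Set
  IsPath p = Unique (vertices p)

  KEdgeConnected : ℕ → Set
  KEdgeConnected k =
    ∀ (u v : V) → u ≢ v →
    Σ (Fin k → Walk u v) λ P →
      (∀ i → IsPath (P i)) ×
      (∀ i j → i ≢ j → ∀ (e : E) → e ∈ edges (P i) → e ∈ edges (P j) → ⊥)

FinMultigraph : (n m : ℕ) → (Fin m → Fin n) → (Fin m → Fin n) → Graph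
FinMultigraph n m e₁ e₂ = record { V = Fin n ; E = Fin m ; end₁ = e₁ ; end₂ = e₂ }

Loopless : ∀ {n m} → (Fin m → Fin n) → (Fin m → Fin n) → Set
Loopless e₁ e₂ = ∀ e → e₁ e ≢ e₂ e

NoIsolated : ∀ {n m} → (Fin m → Fin n) → (Fin m → Fin n) → Set
NoIsolated {n} {m} e₁ e₂ = ∀ (v : Fin n) → Σ (Fin m) λ e → (e₁ e ≡ v) ⊎ (e₂ e ≡ v)

-- New vertices: the 2m ends of the matching M₀ = {F(e) : e ∈ E(X)},
-- represented as (e , b) with b : Bool; the end (e , false) is labelled
-- end₁ e and (e , true) is labelled end₂ e.

Dart : ℕ → Set
Dart m = Fin m × Bool

module _ {n m : ℕ} (e₁ e₂ : Fin m → Fin n) where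

  label : Dart m → Fin n
  label (e , false) = e₁ e
  label (e , true)  = e₂ e

  -- strict total order on darts (used to pick each unordered pair once)
  _<D_ : Dart m → Dart m → Bool
  (e , b) <D (f , c) = (toℕ e <ᵇ toℕ f) ∨ (⌊ e ≟ f ⌋ ∧ lt b c)
    where
      lt : Bool → Bool → Bool
      lt false true = true
      lt _     _    = false

  -- constituent edge: an unordered pair {d₁,d₂} of distinct darts in the
  -- same cluster cl(v) (every constituent is complete)
  conAdj : Dart m → Dart m → Bool
  conAdj d₁ d₂ = ⌊ label d₁ ≟ label d₂ ⌋ ∧ (d₁ <D d₂)

  TruncEdge : Set
  TruncEdge = Fin m ⊎ Σ (Dart m × Dart m) (λ p → T (conAdj (proj₁ p) (proj₂ p)))

  truncEnd₁ : TruncEdge → Dart m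
  truncEnd₁ (inj₁ e)            = (e , false)
  truncEnd₁ (inj₂ ((d₁ , _) , _)) = d₁

  truncEnd₂ : TruncEdge → Dart m
  truncEnd₂ (inj₁ e)            = (e , true)
  truncEnd₂ (inj₂ ((_ , d₂) , _)) = d₂

  CompleteTruncation : Graph
  CompleteTruncation = record
    { V = Dart m ; E = TruncEdge ; end₁ = truncEnd₁ ; end₂ = truncEnd₂ }

-- Walks of X lift to Y: an X-edge is crossed along its matching edge, and inside a cluster one
-- moves along at most one constituent edge. For darts a, b in different clusters, lift k
-- edge-disjoint walks between their labels; two lifts could share only a constituent edge
-- joining a and b, and there is none. For darts a, b of one cluster cl(v), lift k edge-disjoint
-- walks from the far end a′ of the matching edge at a to v: they enter cl(v) at k distinct
-- darts zᵢ. The index with zᵢ = b, if any, uses a → a′ → lift; every other index uses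
-- a → zᵢ → b inside cl(v). Walks are then shortened to paths.
module Submission where

open import Defs
open import Data.Nat using (ℕ; _≥_)
import Data.Nat as Nat
open import Data.Nat.Properties using (<-cmp; <-irrefl; <⇒<ᵇ; <ᵇ⇒<)
open import Data.Fin using (Fin; toℕ)
open import Data.Fin.Properties using (_≟_; toℕ-injective)
open import Data.Bool using (Bool; true; false; T; not)
import Data.Bool.Properties as Bool
open import Data.Product using (Σ; _×_; _,_; proj₁; proj₂; map₂)
open import Data.Product.Properties using (≡-dec)
open import Data.Sum using (_⊎_; inj₁; inj₂)
open import Data.Unit using (⊤; tt)
open import Data.Empty using (⊥; ⊥-elim)
open import Data.List using ([]; _∷_)
open import Data.List.Membership.Propositional using (_∈_)
open import Data.List.Relation.Binary.Subset.Propositional using (_⊆_)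
open import Data.List.Relation.Unary.Any using (here; there; any?)
open import Data.List.Relation.Unary.All as All using (All; []; _∷_)
open import Data.List.Relation.Unary.All.Properties using (¬Any⇒All¬)
open import Data.List.Relation.Unary.AllPairs using ([]; _∷_)
open import Function using (id; _∘_)
open import Function.Bundles using (module Equivalence)
open Equivalence using (to; from)
open import Relation.Binary using (DecidableEquality; tri<; tri≈; tri>)
open import Relation.Binary.PropositionalEquality using (_≡_; _≢_; refl; sym; trans; cong; subst)
open import Relation.Nullary using (yes; no; ¬_)
open import Relation.Nullary.Decidable using (⌊_⌋; toWitness; fromWitness)
import Relation.Unary as U

module _ {G : Graph} where
  open Graph G

  _++ʷ_ : ∀ {u w v} → Walk G u w → Walk G w v → Walk G u v
  [] ++ʷ q = q
  step e j p ++ʷ q = step e j (p ++ʷ q)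

  All-edges-++ʷ : ∀ {R : E → Set} {u w v} (p : Walk G u w) {q : Walk G w v} →
                  All R (edges G p) → All R (edges G q) → All R (edges G (p ++ʷ q))
  All-edges-++ʷ []           []         Rq = Rq
  All-edges-++ʷ (step e j p) (Re ∷ Rp) Rq = Re ∷ All-edges-++ʷ p Rp Rq

  suffixPath : ∀ {w v} (p : Walk G w v) → IsPath G p → ∀ {u} → u ∈ vertices G p →
               Σ (Walk G u v) λ r → IsPath G r × edges G r ⊆ edges G p
  suffixPath []           p-path      (here refl) = [] , p-path , id
  suffixPath (step e j p) p-path      (here refl) = step e j p , p-path , id
  suffixPath (step e j p) (_ ∷ p-path) (there u∈p) =
    map₂ (map₂ (λ r⊆p t∈r → there (r⊆p t∈r))) (suffixPath p p-path u∈p)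

  toPath : DecidableEquality V → ∀ {u v} (p : Walk G u v) →
           Σ (Walk G u v) λ r → IsPath G r × edges G r ⊆ edges G p
  toPath _≟ᵛ_ []                   = [] , [] ∷ [] , id
  toPath _≟ᵛ_ {u} (step e j p) with toPath _≟ᵛ_ p
  ... | r , r-path , r⊆p with any? (u ≟ᵛ_) (vertices G r)
  ...   | yes u∈r = map₂ (map₂ (λ s⊆r t∈s → there (r⊆p (s⊆r t∈s)))) (suffixPath r r-path u∈r)
  ...   | no  u∉r = step e j r , ¬Any⇒All¬ _ u∉r ∷ r-path , λ where
                      (here t≡e) → here t≡e
                      (there t∈r) → there (r⊆p t∈r)

  EdgeDisjoint : ∀ {k u v} → (Fin k → Walk G u v) → Set
  EdgeDisjoint P = ∀ i j → i ≢ j → ∀ (e : E) → e ∈ edges G (P i) → e ∈ edges G (P j) → ⊥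

  EdgeDisjointWalks : ℕ → Set
  EdgeDisjointWalks k = ∀ (u v : V) → u ≢ v → Σ (Fin k → Walk G u v) EdgeDisjoint

  kEdgeConnected⇒edgeDisjointWalks : ∀ {k} → KEdgeConnected G k → EdgeDisjointWalks k
  kEdgeConnected⇒edgeDisjointWalks conn u v u≢v = map₂ proj₂ (conn u v u≢v)

  edgeDisjointWalks⇒kEdgeConnected : DecidableEquality V → ∀ {k} →
                                     EdgeDisjointWalks k → KEdgeConnected G k
  edgeDisjointWalks⇒kEdgeConnected _≟ᵛ_ walks u v u≢v =
    (λ i → proj₁ (short i)) , (λ i → proj₁ (proj₂ (short i))) ,
    λ i j i≢j e e∈i e∈j →
      P-disjoint i j i≢j e (proj₂ (proj₂ (short i)) e∈i) (proj₂ (proj₂ (short j)) e∈j)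
    where
    P = proj₁ (walks u v u≢v)
    P-disjoint = proj₂ (walks u v u≢v)
    short = λ i → toPath _≟ᵛ_ (P i)

module _ (G : Graph) where
  open Graph G

  Joins-sym : ∀ t {u w} → Joins G t u w → Joins G t w u
  Joins-sym _ (inj₁ (p , q)) = inj₂ (q , p)
  Joins-sym _ (inj₂ (p , q)) = inj₁ (q , p)

  Joins-ends : ∀ t {u w u′ w′} → Joins G t u w → Joins G t u′ w′ →
               (u ≡ u′ × w ≡ w′) ⊎ (u ≡ w′ × w ≡ u′)
  Joins-ends _ (inj₁ (refl , refl)) (inj₁ (refl , refl)) = inj₁ (refl , refl)
  Joins-ends _ (inj₁ (refl , refl)) (inj₂ (refl , refl)) = inj₂ (refl , refl)
  Joins-ends _ (inj₂ (refl , refl)) (inj₁ (refl , refl)) = inj₂ (refl , refl)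
  Joins-ends _ (inj₂ (refl , refl)) (inj₂ (refl , refl)) = inj₁ (refl , refl)

_≟ᴰ_ : ∀ {m} → DecidableEquality (Dart m)
_≟ᴰ_ = ≡-dec _≟_ Bool._≟_

module Truncation {n m : ℕ} (e₁ e₂ : Fin m → Fin n) where

  X : Graph
  X = FinMultigraph n m e₁ e₂

  Y : Graph
  Y = CompleteTruncation e₁ e₂

  ℓ : Dart m → Fin n
  ℓ = label e₁ e₂

  opposite : Dart m → Dart m
  opposite (e , b) = (e , not b)

  label-opposite : Loopless e₁ e₂ → ∀ d → ℓ (opposite d) ≢ ℓ d
  label-opposite loopless (e , false) eq = loopless e (sym eq)
  label-opposite loopless (e , true)  eq = loopless e eq

  matching-joins : ∀ d → Joins Y (inj₁ (proj₁ d)) d (opposite d)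
  matching-joins (e , false) = inj₁ (refl , refl)
  matching-joins (e , true)  = inj₂ (refl , refl)

  matching-crosses : Loopless e₁ e₂ → ∀ {e c d} → Joins Y (inj₁ e) c d → ℓ c ≢ ℓ d
  matching-crosses loopless (inj₁ (refl , refl)) = loopless _
  matching-crosses loopless (inj₂ (refl , refl)) = loopless _ ∘ sym

  ConEdge : Set
  ConEdge = Σ (Dart m × Dart m) λ p → T (conAdj e₁ e₂ (proj₁ p) (proj₂ p))

  _≺_ : Dart m → Dart m → Bool
  _≺_ = _<D_ e₁ e₂

  ≺-byEdge : ∀ {e f} b b′ → toℕ e Nat.< toℕ f → T ((e , b) ≺ (f , b′))
  ≺-byEdge _ _ e<f = from Bool.T-∨ (inj₁ (<⇒<ᵇ e<f))

  ≺-bySide : ∀ e → T ((e , false) ≺ (e , true))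
  ≺-bySide e = from Bool.T-∨ (inj₂ (from Bool.T-∧ (fromWitness {a? = e ≟ e} refl , tt)))

  ≺-irrefl : ∀ d → ¬ T (d ≺ d)
  ≺-irrefl (e , b) d≺d with to Bool.T-∨ d≺d
  ... | inj₁ e<e = <-irrefl refl (<ᵇ⇒< (toℕ e) (toℕ e) e<e)
  ... | inj₂ b<b with b
  ...   | false = proj₂ (to Bool.T-∧ b<b)
  ...   | true  = proj₂ (to Bool.T-∧ b<b)

  ≺-connex : ∀ c d → c ≢ d → T (c ≺ d) ⊎ T (d ≺ c)
  ≺-connex (e , b) (f , b′) c≢d with <-cmp (toℕ e) (toℕ f)
  ... | tri< e<f _ _ = inj₁ (≺-byEdge b b′ e<f)
  ... | tri> _ _ f<e = inj₂ (≺-byEdge b′ b f<e)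
  ... | tri≈ _ e≡f _ with toℕ-injective e≡f | b | b′
  ...   | refl | false | true  = inj₁ (≺-bySide e)
  ...   | refl | true  | false = inj₂ (≺-bySide e)
  ...   | refl | false | false = ⊥-elim (c≢d refl)
  ...   | refl | true  | true  = ⊥-elim (c≢d refl)

  conAdj-split : ∀ {c d} → T (conAdj e₁ e₂ c d) → T ⌊ ℓ c ≟ ℓ d ⌋ × T (c ≺ d)
  conAdj-split {c} {d} = to (Bool.T-∧ {⌊ ℓ c ≟ ℓ d ⌋} {c ≺ d})

  conAdj-label : ∀ {c d} → T (conAdj e₁ e₂ c d) → ℓ c ≡ ℓ d
  conAdj-label {c} {d} adj = toWitness (proj₁ (conAdj-split {c} {d} adj))

  conAdj-irrefl : ∀ d → ¬ T (conAdj e₁ e₂ d d)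
  conAdj-irrefl d adj = ≺-irrefl d (proj₂ (conAdj-split {d} {d} adj))

  conAdj-intro : ∀ {c d} → ℓ c ≡ ℓ d → T (c ≺ d) → T (conAdj e₁ e₂ c d)
  conAdj-intro l c≺d = from Bool.T-∧ (fromWitness l , c≺d)

  constituentBetween : ∀ {c d} → ℓ c ≡ ℓ d → c ≢ d → Σ ConEdge λ s → Joins Y (inj₂ s) c d
  constituentBetween {c} {d} l c≢d with ≺-connex c d c≢d
  ... | inj₁ c≺d = ((c , d) , conAdj-intro {c} {d} l c≺d) , inj₁ (refl , refl)
  ... | inj₂ d≺c = ((d , c) , conAdj-intro {d} {c} (sym l) d≺c) , inj₂ (refl , refl)

  Confined : (Fin m → Set) → (Dart m → Set) → TruncEdge e₁ e₂ → Set
  Confined M P (inj₁ e)                = M e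
  Confined M P (inj₂ ((d₁ , d₂) , _)) = P d₁ × P d₂

  Confined-constituent : ∀ {M P c d} s → Joins Y (inj₂ s) c d → P c → P d → Confined M P (inj₂ s)
  Confined-constituent _ (inj₁ (refl , refl)) Pc Pd = Pc , Pd
  Confined-constituent _ (inj₂ (refl , refl)) Pc Pd = Pd , Pc

  -- An edge inside one cluster cannot be a matching edge, since X has no loops.
  Confined-withinCluster : Loopless e₁ e₂ → ∀ {M P t c d} → Confined M P t →
                           Joins Y t c d → ℓ c ≡ ℓ d → P c
  Confined-withinCluster loopless {t = inj₁ _} _ t-joins l =
    ⊥-elim (matching-crosses loopless t-joins l)
  Confined-withinCluster loopless {t = inj₂ _} (Pd₁ , _) (inj₁ (refl , refl)) _ = Pd₁
  Confined-withinCluster loopless {t = inj₂ _} (_ , Pd₂) (inj₂ (refl , refl)) _ = Pd₂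

  inCluster : (c d : Dart m) → ℓ c ≡ ℓ d → Walk Y c d
  inCluster c d l with c ≟ᴰ d
  ... | yes refl = []
  ... | no  c≢d  = step (inj₂ s) s-joins []
    where
    s = proj₁ (constituentBetween l c≢d)
    s-joins = proj₂ (constituentBetween l c≢d)

  inCluster-joins : ∀ c d l → All (λ t → Joins Y t c d) (edges Y (inCluster c d l))
  inCluster-joins c d l with c ≟ᴰ d
  ... | yes refl = []
  ... | no  c≢d  = proj₂ (constituentBetween l c≢d) ∷ []

  inCluster-confined : ∀ {M P} c d l → P c → P d → All (Confined M P) (edges Y (inCluster c d l))
  inCluster-confined {M} {P} c d l Pc Pd with c ≟ᴰ d
  ... | yes refl = []
  ... | no  c≢d  = Confined-constituent {M} {P} s s-joins Pc Pd ∷ []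
    where
    s = proj₁ (constituentBetween l c≢d)
    s-joins = proj₂ (constituentBetween l c≢d)

  side : ∀ {e u w} → Joins X e u w → Bool
  side (inj₁ _) = false
  side (inj₂ _) = true

  departure : ∀ {e u w} → Joins X e u w → Dart m
  departure {e} j = (e , side j)

  label-departure : ∀ {e u w} (j : Joins X e u w) → ℓ (departure j) ≡ u
  label-departure (inj₁ (p , _)) = p
  label-departure (inj₂ (p , _)) = p

  label-arrival : ∀ {e u w} (j : Joins X e u w) → ℓ (opposite (departure j)) ≡ w
  label-arrival (inj₁ (_ , q)) = q
  label-arrival (inj₂ (_ , q)) = q

  liftEnd : ∀ {u v} → Walk X u v → Dart m → Dart m
  liftEnd []           a = a
  liftEnd (step e j q) a = liftEnd q (opposite (departure j))

  lift : ∀ {u v} (q : Walk X u v) (a : Dart m) → ℓ a ≡ u → Walk Y a (liftEnd q a)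
  lift []           a _   = []
  lift (step e j q) a a∈u =
    inCluster a (departure j) (trans a∈u (sym (label-departure j))) ++ʷ
    step (inj₁ e) (matching-joins (departure j)) (lift q (opposite (departure j)) (label-arrival j))

  label-liftEnd : ∀ {u v} (q : Walk X u v) a → ℓ a ≡ u → ℓ (liftEnd q a) ≡ v
  label-liftEnd []           a a∈u = a∈u
  label-liftEnd (step e j q) a _   = label-liftEnd q _ (label-arrival j)

  liftEnd-edge : ∀ {u v} (q : Walk X u v) d → proj₁ (liftEnd q d) ∈ proj₁ d ∷ edges X q
  liftEnd-edge []           d = here refl
  liftEnd-edge (step e j q) d = there (liftEnd-edge q _)

  liftEnd-edge-≢ : ∀ {u v} (q : Walk X u v) a → u ≢ v → proj₁ (liftEnd q a) ∈ edges X q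
  liftEnd-edge-≢ []           a u≢v = ⊥-elim (u≢v refl)
  liftEnd-edge-≢ (step e j q) a _   = liftEnd-edge q _

  lift-confined : ∀ {M P u v} (q : Walk X u v) a a∈u →
                  (_∈ edges X q) U.⊆ M → (λ d → proj₁ d ∈ edges X q) U.⊆ P → P a →
                  All (Confined M P) (edges Y (lift q a a∈u))
  lift-confined []                   a _   _   _   _  = []
  lift-confined {M} {P} (step e j q) a a∈u q⊆M q⊆P Pa =
    All-edges-++ʷ (inCluster a (departure j) a∼dep)
      (inCluster-confined {M} {P} a (departure j) a∼dep Pa (q⊆P (here refl)))
      (q⊆M (here refl) ∷
       lift-confined q _ (label-arrival j) (λ f∈q → q⊆M (there f∈q)) (λ d∈q → q⊆P (there d∈q))
         (q⊆P (here refl)))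
    where
    a∼dep = trans a∈u (sym (label-departure j))

  module AcrossClusters {k} (walks : EdgeDisjointWalks {X} k) (a b : Dart m) (a≁b : ℓ a ≢ ℓ b) where

    Q : Fin k → Walk X (ℓ a) (ℓ b)
    Q = proj₁ (walks (ℓ a) (ℓ b) a≁b)

    Q-disjoint : EdgeDisjoint {X} Q
    Q-disjoint = proj₂ (walks (ℓ a) (ℓ b) a≁b)

    W : ∀ i → Walk Y a b
    W i = lift (Q i) a refl ++ʷ inCluster (liftEnd (Q i) a) b (label-liftEnd (Q i) a refl)

    Near : Fin k → Dart m → Set
    Near i d = d ≡ a ⊎ d ≡ b ⊎ proj₁ d ∈ edges X (Q i)

    W-confined : ∀ i → All (Confined (_∈ edges X (Q i)) (Near i)) (edges Y (W i))
    W-confined i =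
      All-edges-++ʷ (lift (Q i) a refl)
        (lift-confined (Q i) a refl id (inj₂ ∘ inj₂) (inj₁ refl))
        (inCluster-confined _ b _ (inj₂ (inj₂ (liftEnd-edge-≢ (Q i) a a≁b))) (inj₂ (inj₁ refl)))

    near-both : ∀ {i j d} → i ≢ j → Near i d → Near j d → d ≡ a ⊎ d ≡ b
    near-both _   (inj₁ d≡a)         _                  = inj₁ d≡a
    near-both _   (inj₂ (inj₁ d≡b))  _                  = inj₂ d≡b
    near-both _   (inj₂ (inj₂ _))    (inj₁ d≡a)         = inj₁ d≡a
    near-both _   (inj₂ (inj₂ _))    (inj₂ (inj₁ d≡b))  = inj₂ d≡b
    near-both i≢j (inj₂ (inj₂ d∈Qi)) (inj₂ (inj₂ d∈Qj)) = ⊥-elim (Q-disjoint _ _ i≢j _ d∈Qi d∈Qj)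

    W-disjoint : EdgeDisjoint {Y} W
    W-disjoint i j i≢j t t∈Wi t∈Wj =
      clash t (All.lookup (W-confined i) t∈Wi) (All.lookup (W-confined j) t∈Wj)
      where
      clash : ∀ t → Confined (_∈ edges X (Q i)) (Near i) t →
              Confined (_∈ edges X (Q j)) (Near j) t → ⊥
      clash (inj₁ e) e∈Qi e∈Qj = Q-disjoint i j i≢j e e∈Qi e∈Qj
      clash (inj₂ ((d₁ , d₂) , adj)) (i₁ , i₂) (j₁ , j₂)
        with near-both i≢j i₁ j₁ | near-both i≢j i₂ j₂
      ... | inj₁ refl | inj₁ refl = conAdj-irrefl a adj
      ... | inj₂ refl | inj₂ refl = conAdj-irrefl b adj
      ... | inj₁ refl | inj₂ refl = a≁b (conAdj-label {a} {b} adj)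
      ... | inj₂ refl | inj₁ refl = a≁b (sym (conAdj-label {b} {a} adj))

  module WithinCluster (loopless : Loopless e₁ e₂) {k} (walks : EdgeDisjointWalks {X} k)
                       (a b : Dart m) (a∼b : ℓ a ≡ ℓ b) where

    a′ : Dart m
    a′ = opposite a

    a′≁a : ℓ a′ ≢ ℓ a
    a′≁a = label-opposite loopless a

    Q : Fin k → Walk X (ℓ a′) (ℓ a)
    Q = proj₁ (walks (ℓ a′) (ℓ a) a′≁a)

    Q-disjoint : EdgeDisjoint {X} Q
    Q-disjoint = proj₂ (walks (ℓ a′) (ℓ a) a′≁a)

    z : Fin k → Dart m
    z i = liftEnd (Q i) a′

    z∼a : ∀ i → ℓ (z i) ≡ ℓ a
    z∼a i = label-liftEnd (Q i) a′ refl

    z∈Q : ∀ i → proj₁ (z i) ∈ edges X (Q i)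
    z∈Q i = liftEnd-edge-≢ (Q i) a′ a′≁a

    z-injective : ∀ {i j} → i ≢ j → z i ≢ z j
    z-injective {i} {j} i≢j zi≡zj =
      Q-disjoint i j i≢j _ (z∈Q i) (subst (λ d → proj₁ d ∈ edges X (Q j)) (sym zi≡zj) (z∈Q j))

    Beyond : Fin k → Dart m → Set
    Beyond i d = d ≡ a′ ⊎ proj₁ d ∈ edges X (Q i)

    Outer : Fin k → TruncEdge e₁ e₂ → Set
    Outer i = Confined (λ _ → ⊤) (Beyond i)

    Spoke : Fin k → TruncEdge e₁ e₂ → Set
    Spoke i t = Σ (Dart m) λ x → (x ≡ a ⊎ x ≡ b) × Joins Y t (z i) x

    outer : ∀ i → z i ≡ b → Σ (Walk Y a b) λ w → All (Outer i) (edges Y w)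
    outer i zi≡b =
      step (inj₁ (proj₁ a)) (matching-joins a) (lift (Q i) a′ refl ++ʷ inCluster (z i) b zi∼b) ,
      tt ∷ All-edges-++ʷ (lift (Q i) a′ refl)
             (lift-confined (Q i) a′ refl (λ _ → tt) inj₂ (inj₁ refl))
             (inCluster-confined (z i) b zi∼b (inj₂ (z∈Q i))
               (inj₂ (subst (λ d → proj₁ d ∈ edges X (Q i)) zi≡b (z∈Q i))))
      where
      zi∼b = trans (z∼a i) a∼b

    inner : ∀ i → Σ (Walk Y a b) λ w → All (Spoke i) (edges Y w)
    inner i =
      inCluster a (z i) a∼zi ++ʷ inCluster (z i) b zi∼b ,
      All-edges-++ʷ (inCluster a (z i) a∼zi)
        (All.map (λ {t} t-joins → a , inj₁ refl , Joins-sym Y t t-joins)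
          (inCluster-joins a (z i) a∼zi))
        (All.map (λ t-joins → b , inj₂ refl , t-joins) (inCluster-joins (z i) b zi∼b))
      where
      a∼zi = sym (z∼a i)
      zi∼b = trans (z∼a i) a∼b

    Route : Fin k → Walk Y a b → Set
    Route i w = (z i ≡ b × All (Outer i) (edges Y w)) ⊎ (z i ≢ b × All (Spoke i) (edges Y w))

    route : ∀ i → Σ (Walk Y a b) (Route i)
    route i with z i ≟ᴰ b
    ... | yes zi≡b = map₂ (λ o → inj₁ (zi≡b , o)) (outer i zi≡b)
    ... | no  zi≢b = map₂ (λ s → inj₂ (zi≢b , s)) (inner i)

    W : ∀ i → Walk Y a b
    W i = proj₁ (route i)

    x∼a : ∀ {x} → x ≡ a ⊎ x ≡ b → ℓ x ≡ ℓ a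
    x∼a (inj₁ refl) = refl
    x∼a (inj₂ refl) = sym a∼b

    outer-spoke : ∀ {i j} t → i ≢ j → Outer i t → Spoke j t → ⊥
    outer-spoke {i} {j} t i≢j t-outer (x , x∈ab , t-joins)
      with Confined-withinCluster loopless {P = Beyond i} {t = t} t-outer t-joins
             (trans (z∼a j) (sym (x∼a x∈ab)))
    ... | inj₁ zj≡a′ = a′≁a (trans (cong ℓ (sym zj≡a′)) (z∼a j))
    ... | inj₂ zj∈Qi = Q-disjoint j i (i≢j ∘ sym) _ (z∈Q j) zj∈Qi

    spoke-spoke : ∀ {i j} t → i ≢ j → z i ≢ b → z j ≢ b → Spoke i t → Spoke j t → ⊥
    spoke-spoke t i≢j zi≢b zj≢b (x , x∈ab , ti) (y , y∈ab , tj) with Joins-ends Y t ti tj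
    ... | inj₁ (zi≡zj , _)   = z-injective i≢j zi≡zj
    ... | inj₂ (zi≡y , x≡zj) =
      z-injective i≢j (trans (≡a-unless-b zi≡y y∈ab zi≢b) (sym (≡a-unless-b (sym x≡zj) x∈ab zj≢b)))
      where
      ≡a-unless-b : ∀ {c d} → d ≡ c → c ≡ a ⊎ c ≡ b → d ≢ b → d ≡ a
      ≡a-unless-b d≡c (inj₁ c≡a) _   = trans d≡c c≡a
      ≡a-unless-b d≡c (inj₂ c≡b) d≢b = ⊥-elim (d≢b (trans d≡c c≡b))

    W-disjoint : EdgeDisjoint {Y} W
    W-disjoint i j i≢j t = clash (route i) (route j)
      where
      clash : (ri : Σ _ (Route i)) (rj : Σ _ (Route j)) →
              t ∈ edges Y (proj₁ ri) → t ∈ edges Y (proj₁ rj) → ⊥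
      clash (_ , inj₁ (zi≡b , _))  (_ , inj₁ (zj≡b , _))  _  _  =
        z-injective i≢j (trans zi≡b (sym zj≡b))
      clash (_ , inj₁ (_ , oi))    (_ , inj₂ (_ , sj))    ti tj =
        outer-spoke t i≢j (All.lookup oi ti) (All.lookup sj tj)
      clash (_ , inj₂ (_ , si))    (_ , inj₁ (_ , oj))    ti tj =
        outer-spoke t (i≢j ∘ sym) (All.lookup oj tj) (All.lookup si ti)
      clash (_ , inj₂ (zi≢b , si)) (_ , inj₂ (zj≢b , sj)) ti tj =
        spoke-spoke t i≢j zi≢b zj≢b (All.lookup si ti) (All.lookup sj tj)

  acrossClusters : ∀ {k} → EdgeDisjointWalks {X} k →
                   ∀ a b → ℓ a ≢ ℓ b → Σ (Fin k → Walk Y a b) (EdgeDisjoint {Y})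
  acrossClusters walks a b a≁b = W , W-disjoint
    where open AcrossClusters walks a b a≁b

  withinCluster : Loopless e₁ e₂ → ∀ {k} → EdgeDisjointWalks {X} k →
                  ∀ a b → ℓ a ≡ ℓ b → Σ (Fin k → Walk Y a b) (EdgeDisjoint {Y})
  withinCluster loopless walks a b a∼b = W , W-disjoint
    where open WithinCluster loopless walks a b a∼b

  truncation-edgeDisjointWalks : Loopless e₁ e₂ → ∀ {k} →
                                 EdgeDisjointWalks {X} k → EdgeDisjointWalks {Y} k
  truncation-edgeDisjointWalks loopless walks a b _ with ℓ a ≟ ℓ b
  ... | yes a∼b = withinCluster loopless walks a b a∼b
  ... | no  a≁b = acrossClusters walks a b a≁b

theorem3p6 : (k n m : ℕ) → k ≥ 2 →
    (e₁ e₂ : Fin m → Fin n) → Loopless e₁ e₂ → NoIsolated e₁ e₂ →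
    KEdgeConnected (FinMultigraph n m e₁ e₂) k →
    KEdgeConnected (CompleteTruncation e₁ e₂) k
theorem3p6 k n m _ e₁ e₂ loopless _ X-connected =
  edgeDisjointWalks⇒kEdgeConnected _≟ᴰ_
    (truncation-edgeDisjointWalks loopless (kEdgeConnected⇒edgeDisjointWalks X-connected))
  where open Truncation e₁ e₂
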